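{- Let $r\ge 3$ be odd, let $n\ge r+1$, and let $m$ be an integer with $r+1\le m\le n$. Let $g=\Psi_{2,n}^{(r-1,r)}f$ for some $f\in\mathcal{H}_n^{(r-1)}(\mathbb{F}_2)$, where $(\Psi_{2,n}^{(r-1,r)}f)(e)=\sum_{e'\subseteq e,\ |e'|=r-1} f(e')$ for every $r$-element subset $e$ of the vertex set $V$. Then $K_m^{(r)}-e$ never occurs as an induced subhypergraph in either color of $g$; that is, there is no $m$-element set $X\subseteq V$ and color $c\in\mathbb{F}_2$ such that exactly one $r$-element subset of $X$ has $g$-color different from $c$ and all other $r$-element subsets of $X$ have $g$-color $c$.
   Context: $\mathbb{F}_2$ is the field with two elements. For $2\le k\le n$, $K_n^{(k)}$ is the complete $k$-uniform hypergraph on a fixed $n$-element vertex set $V$ (hyperedges: all $k$-element subsets of $V$), and $\mathcal{H}_n^{(k)}(\mathbb{F}_2)$ is the set of all maps $E(K_n^{(k)})\to\mathbb{F}_2$. $K_m^{(r)}-e$ denotes the complete $r$-uniform hypergraph on $m$ vertices with one hyperedge removed. -}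

module Defs where

open import Data.Nat using (ℕ; zero; suc; _+_; _*_; _≟_)
open import Data.Bool using (Bool; true; false; _xor_)
open import Data.List using (List; []; _∷_; map; _++_)
open import Data.Product using (Σ; ∃; _,_; proj₁)
open import Data.Vec using (_∷_; [])
open import Data.Fin.Subset using (Subset; _⊆_; ∣_∣; inside; outside)
open import Data.Fin.Subset.Properties using (_⊆?_)
open import Relation.Nullary using (yes; no)
open import Relation.Binary.PropositionalEquality using (_≡_)

Odd : ℕ → Set
Odd r = ∃ λ k → r ≡ suc (2 * k)

-- the field F₂, represented by Bool with addition = xor (false = 0, true = 1)
F₂ : Set
F₂ = Bool

Edge : ℕ → ℕ → Set
Edge n k = Σ (Subset n) (λ s → ∣ s ∣ ≡ k)

H : ℕ → ℕ → Set
H n k = Edge n k → F₂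

allSubsets : (n : ℕ) → List (Subset n)
allSubsets zero = [] ∷ []
allSubsets (suc n) = map (outside ∷_) (allSubsets n) ++ map (inside ∷_) (allSubsets n)

sumSub : ∀ {n} (k : ℕ) → H n k → Subset n → List (Subset n) → F₂
sumSub k f e [] = false
sumSub k f e (s ∷ ss) with s ⊆? e | ∣ s ∣ ≟ k
... | yes _ | yes p = f (s , p) xor sumSub k f e ss
... | yes _ | no _ = sumSub k f e ss
... | no _  | _ = sumSub k f e ss

Ψ : ∀ n k r → H n k → H n r
Ψ n k r f (e , _) = sumSub k f e (allSubsets n)

{-# OPTIONS --safe #-}
-- g = Ψ f is the coboundary of f over F₂, and a coboundary is a cocycle: summing g
-- over the r-subsets of an (r+1)-set Y counts every (r-1)-subset of Y twice, so it
-- gives 0. Now take Y = e₀ ∪ {v} with v ∈ X ∖ e₀. The r-subsets of Y other than e₀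
-- are the r sets Y ∖ {u}, u ∈ e₀, all of colour c, so 0 = g(e₀) + r·c = g(e₀) + c
-- because r is odd; hence g(e₀) = c.
module Submission where

open import Defs

open import Algebra.Bundles using (CommutativeRing; CommutativeMonoid)
open import Data.Bool using (true; false; not; _∧_; _xor_)
open import Data.Bool.Properties
  using (xor-∧-commutativeRing; ∧-commutativeMonoid; ∧-identityʳ; ∧-zeroʳ; xor-identityʳ; xor-same;
         not-involutive; ¬-not)
open import Data.Fin using (Fin; zero; suc; _≟_)
open import Data.Fin.Properties using (¬∀⟶∃¬)
open import Data.Fin.Subset using (Subset; _⊆_; _∈_; _∉_; ∣_∣; inside; outside; ⁅_⁆)
open import Data.Fin.Subset.Properties using (_⊆?_; _∈?_; ⊆-trans; p⊆q⇒∣p∣≤∣q∣; ∣⁅x⁆∣≡1; x∈⁅x⁆; x≢y⇒x∉⁅y⁆)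
open import Data.List as List using (List; []; _∷_)
open import Data.Nat using (ℕ; zero; suc; _+_; _*_; _<_; _≤_; _∸_) renaming (_≟_ to _≟ℕ_)
open import Data.Nat.Properties using (*-suc; suc-injective; <⇒≱)
open import Data.Product using (Σ; ∃; _×_; _,_; proj₁)
open import Data.Sum as Sum using (_⊎_; inj₁; inj₂)
open import Data.Vec using ([]; _∷_; lookup; _[_]≔_; here; there)
open import Data.Vec.Properties
  using ([]=⇒lookup; lookup⇒[]=; lookup∘update; lookup∘update′; []≔-idempotent; []≔-lookup)
open import Function using (_∘_; const)
open import Relation.Nullary using (¬_; yes; no; does; contradiction)
open import Relation.Nullary.Decidable using (_→-dec_; decidable-stable)
open import Relation.Binary.PropositionalEquality
  using (_≡_; _≢_; refl; sym; trans; cong; cong₂; subst₂; module ≡-Reasoning)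

open CommutativeRing xor-∧-commutativeRing using (semiring; +-group)
open import Algebra.Properties.Semiring.Sum semiring
  using (sum-syntax; sum-cong-≗; sum-replicate-zero; ∑-comm; ∑-distrib-+; *-distribˡ-sum; *-distribʳ-sum)
open import Algebra.Properties.Group +-group using (∙-cancelˡ; ∙-cancelʳ)
open import Algebra.Properties.CommutativeSemigroup (CommutativeMonoid.commutativeSemigroup ∧-commutativeMonoid)
  using (xy∙z≈xz∙y)

open ≡-Reasoning

private
  variable
    n : ℕ

toF₂ : ℕ → F₂
toF₂ zero = false
toF₂ (suc k) = not (toF₂ k)

toF₂-even : ∀ k → toF₂ (2 * k) ≡ false
toF₂-even zero = refl
toF₂-even (suc k) = trans (cong toF₂ (*-suc 2 k)) (trans (not-involutive _) (toF₂-even k))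

toF₂-odd : ∀ {r} → Odd r → toF₂ r ≡ true
toF₂-odd (k , refl) = cong not (toF₂-even k)

-- A subset is its own F₂-valued indicator: lookup s u = [u ∈ s].
∑-lookup : (s : Subset n) → ∑[ u < n ] lookup s u ≡ toF₂ ∣ s ∣
∑-lookup [] = refl
∑-lookup (inside ∷ s) = cong not (∑-lookup s)
∑-lookup (outside ∷ s) = ∑-lookup s

∑-lookup-∧ : (s : Subset n) (a : F₂) → ∑[ u < n ] (lookup s u ∧ a) ≡ toF₂ ∣ s ∣ ∧ a
∑-lookup-∧ s a = trans (sym (*-distribʳ-sum a (lookup s))) (cong (_∧ a) (∑-lookup s))

⊆⇒lookup : ∀ {s p : Subset n} → s ⊆ p → ∀ x → lookup s x ≡ inside → lookup p x ≡ inside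
⊆⇒lookup {s = s} s⊆p x sx = []=⇒lookup (s⊆p (lookup⇒[]= x s sx))

∉⇒lookup≡outside : ∀ {p : Subset n} {x} → x ∉ p → lookup p x ≡ outside
∉⇒lookup≡outside {p = p} {x} x∉p = ¬-not (x∉p ∘ lookup⇒[]= x p)

∑-∖-even : ∀ {s p : Subset n} → s ⊆ p → ∣ p ∣ ≡ 2 + ∣ s ∣ →
  ∑[ u < n ] (lookup p u ∧ not (lookup s u)) ≡ false
∑-∖-even {n} {s} {p} s⊆p ∣p∣ = ∙-cancelˡ (toF₂ ∣ s ∣) _ false (begin
  toF₂ ∣ s ∣ xor ∑[ u < n ] outside-s u
    ≡⟨ cong (_xor ∑[ u < n ] outside-s u) (sym (∑-lookup s)) ⟩
  ∑[ u < n ] lookup s u xor ∑[ u < n ] outside-s u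
    ≡⟨ sym (∑-distrib-+ (lookup s) outside-s) ⟩
  ∑[ u < n ] (lookup s u xor outside-s u)
    ≡⟨ sum-cong-≗ split ⟩
  ∑[ u < n ] lookup p u
    ≡⟨ ∑-lookup p ⟩
  toF₂ ∣ p ∣
    ≡⟨ trans (cong toF₂ ∣p∣) (not-involutive _) ⟩
  toF₂ ∣ s ∣
    ≡⟨ sym (xor-identityʳ _) ⟩
  toF₂ ∣ s ∣ xor false ∎)
  where
  outside-s : Fin n → F₂
  outside-s u = lookup p u ∧ not (lookup s u)

  split : ∀ u → lookup s u xor outside-s u ≡ lookup p u
  split u with lookup s u in su
  ... | inside rewrite ⊆⇒lookup s⊆p u su = refl
  ... | outside = ∧-identityʳ _

∈∉⇒≢ : ∀ (p : Subset n) {x y} → lookup p x ≡ inside → lookup p y ≡ outside → x ≢ y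
∈∉⇒≢ p px py refl = contradiction (trans (sym px) py) λ ()

∣∣-insert : ∀ (p : Subset n) x → lookup p x ≡ outside → ∣ p [ x ]≔ inside ∣ ≡ suc ∣ p ∣
∣∣-insert (_ ∷ p) zero refl = refl
∣∣-insert (inside ∷ p) (suc x) px = cong suc (∣∣-insert p x px)
∣∣-insert (outside ∷ p) (suc x) px = ∣∣-insert p x px

∣∣-remove : ∀ (p : Subset n) x → lookup p x ≡ inside → suc ∣ p [ x ]≔ outside ∣ ≡ ∣ p ∣
∣∣-remove (_ ∷ p) zero refl = refl
∣∣-remove (inside ∷ p) (suc x) px = cong suc (∣∣-remove p x px)
∣∣-remove (outside ∷ p) (suc x) px = ∣∣-remove p x px

remove∘insert : ∀ (p : Subset n) x → lookup p x ≡ outside → p [ x ]≔ inside [ x ]≔ outside ≡ p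
remove∘insert p x px = trans ([]≔-idempotent p x) (trans (cong (p [ x ]≔_) (sym px)) ([]≔-lookup p x))

remove-⊆ : ∀ (p : Subset n) x → p [ x ]≔ outside ⊆ p
remove-⊆ (_ ∷ p) zero (there y∈p) = there y∈p
remove-⊆ (_ ∷ p) (suc x) here = here
remove-⊆ (_ ∷ p) (suc x) (there y∈p) = there (remove-⊆ p x y∈p)

∈-insert⁻ : ∀ (p : Subset n) x {y} → y ∈ p [ x ]≔ inside → y ≡ x ⊎ y ∈ p
∈-insert⁻ (_ ∷ p) zero here = inj₁ refl
∈-insert⁻ (_ ∷ p) zero (there y∈p) = inj₂ (there y∈p)
∈-insert⁻ (_ ∷ p) (suc x) here = inj₂ here
∈-insert⁻ (_ ∷ p) (suc x) (there y∈p) = Sum.map (cong suc) there (∈-insert⁻ p x y∈p)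

insert-⊆ : ∀ {p q : Subset n} x → p ⊆ q → x ∈ q → p [ x ]≔ inside ⊆ q
insert-⊆ {p = p} x p⊆q x∈q y∈ with ∈-insert⁻ p x y∈
... | inj₁ refl = x∈q
... | inj₂ y∈p = p⊆q y∈p

⊆?-remove : ∀ (s p : Subset n) x → lookup p x ≡ inside →
  does (s ⊆? p [ x ]≔ outside) ≡ does (s ⊆? p) ∧ not (lookup s x)
⊆?-remove (inside ∷ s) (_ ∷ p) zero refl = sym (∧-zeroʳ _)
⊆?-remove (outside ∷ s) (_ ∷ p) zero refl = sym (∧-identityʳ _)
⊆?-remove (inside ∷ s) (inside ∷ p) (suc x) px = ⊆?-remove s p x px
⊆?-remove (inside ∷ s) (outside ∷ p) (suc x) px = refl
⊆?-remove (outside ∷ s) (_ ∷ p) (suc x) px = ⊆?-remove s p x px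

∃-∈-∉ : ∀ (p q : Subset n) → ∣ p ∣ < ∣ q ∣ → ∃ λ x → x ∈ q × x ∉ p
∃-∈-∉ {n} p q ∣p∣<∣q∣ with ¬∀⟶∃¬ n (λ x → x ∈ q → x ∈ p) (λ x → x ∈? q →-dec x ∈? p) q⊈p
  where
  q⊈p : ¬ (∀ x → x ∈ q → x ∈ p)
  q⊈p q⊆p = <⇒≱ ∣p∣<∣q∣ (p⊆q⇒∣p∣≤∣q∣ (q⊆p _))
... | x , x∈q⇏x∈p =
  x , decidable-stable (x ∈? q) (λ x∉q → x∈q⇏x∈p (λ x∈q → contradiction x∈q x∉q)) , x∈q⇏x∈p ∘ const

coboundary : (Subset n → F₂) → Subset n → F₂
coboundary {n} h Y = ∑[ u < n ] (lookup Y u ∧ h (Y [ u ]≔ outside))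

sumBelow : ∀ {m} → (Fin m → Subset n) → (Subset n → F₂) → Subset n → F₂
sumBelow {m = m} S w t = ∑[ i < m ] (does (S i ⊆? t) ∧ w (S i))

-- A k-set s ⊆ Y lies in exactly the two facets Y [ u ]≔ outside with u ∈ Y ∖ s.
-- Nothing is assumed about the family S: it may repeat or omit subsets.
coboundary-sumBelow : ∀ {m k} (S : Fin m → Subset n) (w : Subset n → F₂) →
  (∀ s → w s ≡ true → ∣ s ∣ ≡ k) → ∀ {Y} → ∣ Y ∣ ≡ 2 + k → coboundary (sumBelow S w) Y ≡ false
coboundary-sumBelow {n} {m} S w supported {Y} ∣Y∣ = begin
  ∑[ u < n ] (lookup Y u ∧ ∑[ i < m ] term u (S i))
    ≡⟨ sum-cong-≗ (λ u → *-distribˡ-sum (lookup Y u) (term u ∘ S)) ⟩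
  ∑[ u < n ] ∑[ i < m ] (lookup Y u ∧ term u (S i))
    ≡⟨ ∑-comm (λ u i → lookup Y u ∧ term u (S i)) ⟩
  ∑[ i < m ] ∑[ u < n ] (lookup Y u ∧ term u (S i))
    ≡⟨ sum-cong-≗ (λ i → facets-above (S i)) ⟩
  ∑[ i < m ] false
    ≡⟨ sum-replicate-zero m ⟩
  false ∎
  where
  term : Fin n → Subset n → F₂
  term u s = does (s ⊆? Y [ u ]≔ outside) ∧ w s

  regroup : ∀ s u → lookup Y u ∧ term u s ≡ (does (s ⊆? Y) ∧ w s) ∧ (lookup Y u ∧ not (lookup s u))
  regroup s u with lookup Y u in Yu
  ... | inside = trans (cong (_∧ w s) (⊆?-remove s Y u Yu)) (xy∙z≈xz∙y (does (s ⊆? Y)) _ (w s))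
  ... | outside = sym (∧-zeroʳ _)

  vanishes : ∀ s → (does (s ⊆? Y) ∧ w s) ∧ ∑[ u < n ] (lookup Y u ∧ not (lookup s u)) ≡ false
  vanishes s with s ⊆? Y | w s in ws
  ... | yes s⊆Y | true = ∑-∖-even s⊆Y (trans ∣Y∣ (cong (2 +_) (sym (supported s ws))))
  ... | yes _ | false = refl
  ... | no _ | _ = refl

  facets-above : ∀ s → ∑[ u < n ] (lookup Y u ∧ term u s) ≡ false
  facets-above s = trans (sum-cong-≗ (regroup s))
    (trans (sym (*-distribˡ-sum _ (λ u → lookup Y u ∧ not (lookup s u)))) (vanishes s))

coboundary-insert : ∀ (h : Subset n → F₂) (E : Subset n) {v} c → lookup E v ≡ outside →
  (∀ u → lookup E u ≡ inside → h (E [ v ]≔ inside [ u ]≔ outside) ≡ c) →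
  coboundary h (E [ v ]≔ inside) ≡ h E xor (toF₂ ∣ E ∣ ∧ c)
coboundary-insert {n} h E {v} c Ev other-facets = begin
  ∑[ u < n ] (lookup Y u ∧ h (Y [ u ]≔ outside))
    ≡⟨ sum-cong-≗ split ⟩
  ∑[ u < n ] ((lookup ⁅ v ⁆ u ∧ h E) xor (lookup E u ∧ c))
    ≡⟨ ∑-distrib-+ (λ u → lookup ⁅ v ⁆ u ∧ h E) (λ u → lookup E u ∧ c) ⟩
  ∑[ u < n ] (lookup ⁅ v ⁆ u ∧ h E) xor ∑[ u < n ] (lookup E u ∧ c)
    ≡⟨ cong₂ _xor_ (∑-lookup-∧ ⁅ v ⁆ (h E)) (∑-lookup-∧ E c) ⟩
  (toF₂ ∣ ⁅ v ⁆ ∣ ∧ h E) xor (toF₂ ∣ E ∣ ∧ c)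
    ≡⟨ cong (λ k → (toF₂ k ∧ h E) xor (toF₂ ∣ E ∣ ∧ c)) (∣⁅x⁆∣≡1 v) ⟩
  h E xor (toF₂ ∣ E ∣ ∧ c) ∎
  where
  Y : Subset n
  Y = E [ v ]≔ inside

  on-E : ∀ u → lookup E u ∧ h (Y [ u ]≔ outside) ≡ lookup E u ∧ c
  on-E u with lookup E u in Eu
  ... | inside = other-facets u Eu
  ... | outside = refl

  split : ∀ u → lookup Y u ∧ h (Y [ u ]≔ outside) ≡ (lookup ⁅ v ⁆ u ∧ h E) xor (lookup E u ∧ c)
  split u with u ≟ v
  ... | yes refl
    rewrite lookup∘update v E inside | remove∘insert E v Ev | []=⇒lookup (x∈⁅x⁆ v) | Ev
    = sym (xor-identityʳ (h E))
  ... | no u≢v = begin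
    lookup Y u ∧ h (Y [ u ]≔ outside)
      ≡⟨ cong (_∧ h (Y [ u ]≔ outside)) (lookup∘update′ u≢v E inside) ⟩
    lookup E u ∧ h (Y [ u ]≔ outside)
      ≡⟨ on-E u ⟩
    lookup E u ∧ c
      ≡⟨ cong (λ b → (b ∧ h E) xor (lookup E u ∧ c)) (sym (∉⇒lookup≡outside (x≢y⇒x∉⁅y⁆ u≢v))) ⟩
    (lookup ⁅ v ⁆ u ∧ h E) xor (lookup E u ∧ c) ∎

cocycle-facet : ∀ (h : Subset n → F₂) (E : Subset n) {v} c → lookup E v ≡ outside → toF₂ ∣ E ∣ ≡ true →
  coboundary h (E [ v ]≔ inside) ≡ false →
  (∀ u → lookup E u ≡ inside → h (E [ v ]≔ inside [ u ]≔ outside) ≡ c) → h E ≡ c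
cocycle-facet h E c Ev E-odd cocycle other-facets = ∙-cancelʳ c (h E) c (begin
  h E xor c                   ≡⟨ cong (λ b → h E xor (b ∧ c)) (sym E-odd) ⟩
  h E xor (toF₂ ∣ E ∣ ∧ c)    ≡⟨ sym (coboundary-insert h E c Ev other-facets) ⟩
  coboundary h _              ≡⟨ cocycle ⟩
  false                       ≡⟨ sym (xor-same c) ⟩
  c xor c                     ∎)

∣exchange∣ : ∀ (E : Subset n) {u v} → lookup E u ≡ inside → lookup E v ≡ outside →
  ∣ E [ v ]≔ inside [ u ]≔ outside ∣ ≡ ∣ E ∣
∣exchange∣ E {u} {v} Eu Ev = suc-injective (begin
  suc ∣ E [ v ]≔ inside [ u ]≔ outside ∣ ≡⟨ ∣∣-remove (E [ v ]≔ inside) u Yu ⟩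
  ∣ E [ v ]≔ inside ∣                     ≡⟨ ∣∣-insert E v Ev ⟩
  suc ∣ E ∣                               ∎)
  where
  Yu : lookup (E [ v ]≔ inside) u ≡ inside
  Yu = trans (lookup∘update′ (∈∉⇒≢ E Eu Ev) E inside) Eu

exchange≢ : ∀ (E : Subset n) {u v} → lookup E u ≡ inside → lookup E v ≡ outside →
  E [ v ]≔ inside [ u ]≔ outside ≢ E
exchange≢ E {u} {v} Eu Ev exchange≡E = contradiction (begin
  inside                                     ≡⟨ lookup∘update v E inside ⟨
  lookup (E [ v ]≔ inside) v                 ≡⟨ lookup∘update′ (∈∉⇒≢ E Eu Ev ∘ sym) (E [ v ]≔ inside) outside ⟨
  lookup (E [ v ]≔ inside [ u ]≔ outside) v  ≡⟨ cong (λ t → lookup t v) exchange≡E ⟩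
  lookup E v                                 ≡⟨ Ev ⟩
  outside                                    ∎) λ ()

zeroExtend : ∀ k → H n k → Subset n → F₂
zeroExtend k f s with ∣ s ∣ ≟ℕ k
... | yes ∣s∣≡k = f (s , ∣s∣≡k)
... | no _ = false

zeroExtend-support : ∀ k (f : H n k) s → zeroExtend k f s ≡ true → ∣ s ∣ ≡ k
zeroExtend-support k f s fs with ∣ s ∣ ≟ℕ k
... | yes ∣s∣≡k = ∣s∣≡k
... | no _ = contradiction fs λ ()

sumSub≡sumBelow : ∀ k (f : H n k) e (L : List (Subset n)) →
  sumSub k f e L ≡ sumBelow (List.lookup L) (zeroExtend k f) e
sumSub≡sumBelow k f e [] = refl
sumSub≡sumBelow k f e (s ∷ L) with s ⊆? e | ∣ s ∣ ≟ℕ k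
... | yes _ | yes ∣s∣≡k = cong (f (s , ∣s∣≡k) xor_) (sumSub≡sumBelow k f e L)
... | yes _ | no _ = sumSub≡sumBelow k f e L
... | no _ | _ = sumSub≡sumBelow k f e L

theorem7 : (r n m : ℕ) → 3 ≤ r → Odd r → suc r ≤ n → suc r ≤ m → m ≤ n →
    (f : H n (r ∸ 1)) →
    let g = Ψ n (r ∸ 1) r f in
    ¬ (Σ (Subset n) λ X → ∣ X ∣ ≡ m × Σ F₂ λ c → Σ (Edge n r) λ e₀ →
         (proj₁ e₀ ⊆ X) × (g e₀ ≢ c) ×
         (∀ (e : Edge n r) → proj₁ e ⊆ X → proj₁ e ≢ proj₁ e₀ → g e ≡ c))
theorem7 zero _ _ ()
theorem7 (suc k) n m _ r-odd _ r<m _ f (X , ∣X∣ , c , (E , ∣E∣) , E⊆X , gE≢c , g≡c)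
  with ∃-∈-∉ E X (subst₂ _<_ (sym ∣E∣) (sym ∣X∣) r<m)
... | v , v∈X , v∉E =
  gE≢c (trans (sumSub≡sumBelow k f E L) (cocycle-facet h E c Ev E-odd cocycle other-facets))
  where
  L : List (Subset n)
  L = allSubsets n

  h : Subset n → F₂
  h = sumBelow (List.lookup L) (zeroExtend k f)

  Ev : lookup E v ≡ outside
  Ev = ∉⇒lookup≡outside v∉E

  E-odd : toF₂ ∣ E ∣ ≡ true
  E-odd = trans (cong toF₂ ∣E∣) (toF₂-odd r-odd)

  cocycle : coboundary h (E [ v ]≔ inside) ≡ false
  cocycle = coboundary-sumBelow (List.lookup L) (zeroExtend k f) (zeroExtend-support k f)
    (trans (∣∣-insert E v Ev) (cong suc ∣E∣))

  other-facets : ∀ u → lookup E u ≡ inside → h (E [ v ]≔ inside [ u ]≔ outside) ≡ c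
  other-facets u Eu = trans (sym (sumSub≡sumBelow k f _ L))
    (g≡c (_ , trans (∣exchange∣ E Eu Ev) ∣E∣)
         (⊆-trans (remove-⊆ _ u) (insert-⊆ v E⊆X v∈X))
         (exchange≢ E Eu Ev))
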